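{- Let $\mathbf x$ be an infinite word over a finite alphabet which is not ultimately periodic, and let $n\ge1$ be such that the Rauzy graph $\mathcal G_n(\mathbf x)$ is of $\infty$-shape with bispecial word $w$ and two cycles $U = [w u_1\dots u_{k-1} w]$ and $V = [w v_1 \dots v_{\ell-1} w]$. Assume that $p(m,\mathbf x)/m \le 4/3$ for every $m > n$, and that $U$ is essentially right-special. Then: (i) if $UV^bU$ is a factor of $\mathbf x$ for some integer $b \ge 2$, then $k \ge (2b-3)\ell + 4$; (ii) if $UV^bU$ and $UV^{b'}U$ are factors of $\mathbf x$ for some integers $b,b' \ge 1$, then $b = b'$.
   Context: $p(m,\mathbf x)$ is the number of distinct factors of length $m$ of $\mathbf x$. The Rauzy graph $\mathcal G_n(\mathbf x)$ has as vertices the factors of length $n$ of $\mathbf x$, with an edge $u\to v$ iff $uc = dv$ is a factor of $\mathbf x$ for some letters $c,d$. A path $[u_0u_1\dots u_j]$ with $j$ edges corresponds to the word of length $n+j$ obtained by appending to $u_0$ the last letters of $u_1,\dots,u_j$; its length is $|P|_n = j$; paths are identified with their words, concatenation of paths (end vertex of the first equal to start vertex of the second) is denoted by juxtaposition, and $V^b$ is the $b$-fold concatenation. Thus $|U|_n = k$, $|V|_n = \ell$. A factor $u$ is right-special (left-special) if $uc,ud$ (resp. $cu,du$) are factors for distinct letters $c,d$; bispecial if both. $\mathcal G_n(\mathbf x)$ is of $\infty$-shape if $\mathbf x$ has exactly one special (left- or right-special) word $w$ of length $n$ and there are exactly two paths from $w$ to itself (not passing through $w$ in between). $U$ is essentially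 right-special if the word of $U$ is a suffix of right-special factors of $\mathbf x$ of arbitrarily large length. -}

module Defs where

open import Data.Nat using (ℕ; zero; suc; _+_; _*_; _∸_; _≤_; _<_)
open import Data.Fin using (Fin)
open import Data.List using (List; []; _∷_; _++_; [_]; length; take; drop)
open import Data.List.Relation.Unary.All using (All)
open import Data.List.Relation.Unary.Unique.Propositional using (Unique)
open import Data.Product using (Σ; ∃; ∃-syntax; _×_; _,_)
open import Data.Sum using (_⊎_)
open import Relation.Binary.PropositionalEquality using (_≡_; _≢_)
open import Relation.Nullary using (¬_)

Word : ℕ → Set
Word s = ℕ → Fin s

FWord : ℕ → Set
FWord s = List (Fin s)

window : ∀ {s} → Word s → ℕ → ℕ → FWord s
window x i zero    = []
window x i (suc m) = x i ∷ window x (suc i) m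

Factor : ∀ {s} → Word s → FWord s → Set
Factor x u = ∃[ i ] (window x i (length u) ≡ u)

UltPeriodic : ∀ {s} → Word s → Set
UltPeriodic x = ∃[ p ] ∃[ N ] (0 < p × (∀ i → N ≤ i → x (p + i) ≡ x i))

-- Complexity bound: p(m,x) * d ≤ c * m, i.e. p(m,x)/m ≤ c/d.
-- Stated as: every duplicate-free list of length-m factors of x has
-- length L with L * d ≤ c * m  (so the number of distinct factors of
-- length m satisfies this bound).
ComplexityRatioAtMost : ∀ {s} → Word s → (m c d : ℕ) → Set
ComplexityRatioAtMost {s} x m c d =
  (L : List (FWord s)) → Unique L →
  All (λ u → length u ≡ m × Factor x u) L →
  length L * d ≤ c * m

RightSpecial : ∀ {s} → Word s → FWord s → Set
RightSpecial x u = ∃[ c ] ∃[ d ] (c ≢ d × Factor x (u ++ [ c ]) × Factor x (u ++ [ d ]))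

LeftSpecial : ∀ {s} → Word s → FWord s → Set
LeftSpecial x u = ∃[ c ] ∃[ d ] (c ≢ d × Factor x (c ∷ u) × Factor x (d ∷ u))

Bispecial : ∀ {s} → Word s → FWord s → Set
Bispecial x u = LeftSpecial x u × RightSpecial x u

-- A path in the Rauzy graph G_n(x), identified with its word P
-- (of length n + number of edges): every length-n window is a vertex
-- (a factor) and every length-(n+1) window is an edge (a factor).
RauzyPath : ∀ {s} → Word s → ℕ → FWord s → Set
RauzyPath x n P =
  n ≤ length P ×
  (∀ i → i + n ≤ length P → Factor x (take n (drop i P))) ×
  (∀ i → i + suc n ≤ length P → Factor x (take (suc n) (drop i P)))

pathLen : ∀ {s} → ℕ → FWord s → ℕ
pathLen n P = length P ∸ n

ReturnPath : ∀ {s} → Word s → ℕ → FWord s → FWord s → Set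
ReturnPath x n w P =
  RauzyPath x n P ×
  0 < pathLen n P ×
  take n P ≡ w ×
  drop (pathLen n P) P ≡ w ×
  (∀ i → 0 < i → i < pathLen n P → take n (drop i P) ≢ w)

InftyShape : ∀ {s} → Word s → ℕ → FWord s → FWord s → FWord s → Set
InftyShape {s} x n w U V =
  length w ≡ n ×
  Factor x w ×
  (∀ (u : FWord s) → length u ≡ n → Factor x u →
     (LeftSpecial x u ⊎ RightSpecial x u) → u ≡ w) ×
  ReturnPath x n w U ×
  ReturnPath x n w V ×
  U ≢ V ×
  (∀ (P : FWord s) → ReturnPath x n w P → P ≡ U ⊎ P ≡ V)

-- Concatenation of paths (end vertex of P = start vertex of Q).
_⋆⟨_⟩_ : ∀ {s} → FWord s → ℕ → FWord s → FWord s
P ⋆⟨ n ⟩ Q = P ++ drop n Q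

pathPow : ∀ {s} → ℕ → FWord s → ℕ → FWord s
pathPow n V zero          = take n V
pathPow n V (suc zero)    = V
pathPow n V (suc (suc b)) = V ⋆⟨ n ⟩ pathPow n V (suc b)

EssRightSpecial : ∀ {s} → Word s → FWord s → Set
EssRightSpecial x U =
  ∀ N → ∃[ f ] (N ≤ length f × RightSpecial x f × ∃[ y ] (f ≡ y ++ U))

module Submission where

-- In an ∞-shaped Rauzy graph every vertex other than w has at most one successor and at most one
-- predecessor, so a return path to w is determined by its first letter after w, and also by its
-- last letter before w: U and V leave w by different letters and enter it by different letters.
-- Both k and ℓ are periods of w, so by Fine–Wilf two such paths would coincide if k + ℓ ≤ n + 1;
-- hence k + ℓ ≥ n + 2.
-- A factor U V^b U with b ≥ 2, or two factors U V^b U and U V^b′ U with b < b′, produces a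
-- right-special word A of length n + D ending in V's last letter before w, followed by w.  Its suffixes
-- and those of the arbitrarily long right-special words ending in U give two right-special factors of
-- each length in (n, n + D]; together with the suffixes of w this yields p(n + 1 + D) ≥ n + 2 + 2D,
-- and p(m) ≤ 4m/3 forces 2D + 2 ≤ n.  With D = (b − 1)ℓ this is (i); with D = k + bℓ ≥ k + ℓ ≥ n + 2
-- it is absurd, which is (ii).

open import Defs
open import Data.Empty using (⊥; ⊥-elim)
open import Data.Fin using (Fin)
import Data.Fin as Fin
open import Data.List using (List; []; _∷_; _++_; [_]; length; take; drop; map; initLast; _∷ʳ′_)
open import Data.List.Properties
  using (++-assoc; ++-identityʳ; length-++; length-map; length-drop; take++drop≡id; take-drop; drop-drop; take-all;
         ∷-injectiveˡ; ∷-injectiveʳ; ∷ʳ-injectiveʳ; ∷ʳ-++; ++-cancelʳ; ++-monoid; ≡-dec)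
open import Data.List.Membership.Propositional using (_∈_; _∉_)
open import Data.List.Membership.Propositional.Properties using (∈-map⁺)
open import Data.List.Relation.Unary.All as All using (All; []; _∷_)
import Data.List.Relation.Unary.All.Properties as All
open import Data.List.Relation.Unary.AllPairs using ([]; _∷_)
open import Data.List.Relation.Unary.Any using (here; there)
open import Data.List.Relation.Unary.Unique.Propositional using (Unique)
import Data.List.Relation.Unary.Unique.Propositional.Properties as Unique
open import Data.Nat
open import Data.Nat.Properties
open import Data.Nat.Tactic.RingSolver using (solve-∀)
open import Data.Product using (∃; ∃-syntax; _×_; _,_; proj₁; proj₂)
open import Induction.WellFounded using (Acc; acc)
open import Data.Nat.Induction using (<-wellFounded)
open import Data.Sum using (_⊎_; inj₁; inj₂)
open import Relation.Binary.PropositionalEquality hiding ([_])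
open import Relation.Binary.Definitions using (tri<; tri≈; tri>)
open import Relation.Nullary using (¬_; yes; no)

module _ {a} {A : Set a} where

  drop-++-length : (p q : List A) → drop (length p) (p ++ q) ≡ q
  drop-++-length []      q = refl
  drop-++-length (_ ∷ p) q = drop-++-length p q

  ++-injective-length : (p r q t : List A) → length p ≡ length r → p ++ q ≡ r ++ t → p ≡ r × q ≡ t
  ++-injective-length []      []      q t _ e = refl , e
  ++-injective-length (c ∷ p) (d ∷ r) q t l e with refl ← ∷-injectiveˡ e
    with refl , e′ ← ++-injective-length p r q t (suc-injective l) (∷-injectiveʳ e) = refl , e′

  power : ℕ → List A → List A
  power zero    v = []
  power (suc b) v = v ++ power b v

  power-suc : ∀ b (v : List A) → power (suc b) v ≡ power b v ++ v
  power-suc zero    v = ++-identityʳ v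
  power-suc (suc b) v = trans (cong (v ++_) (power-suc b v)) (sym (++-assoc v (power b v) v))

  power-+ : ∀ b c (v : List A) → power (b + c) v ≡ power b v ++ power c v
  power-+ zero    c v = refl
  power-+ (suc b) c v = trans (cong (v ++_) (power-+ b c v)) (sym (++-assoc v (power b v) (power c v)))

  length-power : ∀ b (v : List A) → length (power b v) ≡ b * length v
  length-power zero    v = refl
  length-power (suc b) v = trans (length-++ v) (cong (length v +_) (length-power b v))

  power-conjugate : ∀ (w v v′ : List A) → w ++ v ≡ v′ ++ w → ∀ b → w ++ power b v ≡ power b v′ ++ w
  power-conjugate w v v′ e zero    = ++-identityʳ w
  power-conjugate w v v′ e (suc b) = begin
    w ++ (v ++ power b v)    ≡⟨ ++-assoc w v _ ⟨
    (w ++ v) ++ power b v    ≡⟨ cong (_++ power b v) e ⟩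
    (v′ ++ w) ++ power b v   ≡⟨ ++-assoc v′ w _ ⟩
    v′ ++ (w ++ power b v)   ≡⟨ cong (v′ ++_) (power-conjugate w v v′ e b) ⟩
    v′ ++ (power b v′ ++ w)  ≡⟨ ++-assoc v′ _ w ⟨
    (v′ ++ power b v′) ++ w  ∎
    where open ≡-Reasoning

  take-++-length : ∀ (p q : List A) → take (length p) (p ++ q) ≡ p
  take-++-length []      q = refl
  take-++-length (c ∷ p) q = cong (c ∷_) (take-++-length p q)

  length-snoc : ∀ (p : List A) c → length (p ++ [ c ]) ≡ suc (length p)
  length-snoc p c = trans (length-++ p) (+-comm (length p) 1)

  length-take-≤ : ∀ m (P : List A) → m ≤ length P → length (take m P) ≡ m
  length-take-≤ zero    P       _         = refl
  length-take-≤ (suc m) (_ ∷ P) (s≤s m≤P) = cong suc (length-take-≤ m P m≤P)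

  length-take-drop : ∀ j m (P : List A) → j + m ≤ length P → length (take m (drop j P)) ≡ m
  length-take-drop zero    m P       le       = length-take-≤ m P le
  length-take-drop (suc j) m (_ ∷ P) (s≤s le) = length-take-drop j m P le

  drop-∷ : ∀ m (P : List A) → m < length P → ∃[ e ] (drop m P ≡ e ∷ drop (suc m) P)
  drop-∷ zero    (e ∷ P) _        = e , refl
  drop-∷ (suc m) (_ ∷ P) (s≤s lt) = drop-∷ m P lt

  take-suc-∷ʳ : ∀ m (P : List A) {e t} → drop m P ≡ e ∷ t → take (suc m) P ≡ take m P ++ [ e ]
  take-suc-∷ʳ zero    (e ∷ P) refl = refl
  take-suc-∷ʳ (suc m) (c ∷ P) eq   = cong (c ∷_) (take-suc-∷ʳ m P eq)

  take-suc-++-length : ∀ (p : List A) c t → take (suc (length p)) (p ++ c ∷ t) ≡ p ++ [ c ]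
  take-suc-++-length []      c t = refl
  take-suc-++-length (e ∷ p) c t = cong (e ∷_) (take-suc-++-length p c t)

  window-of-prefix : ∀ j m (P Q : List A) → take (j + m) P ≡ take (j + m) Q → take m (drop j P) ≡ take m (drop j Q)
  window-of-prefix j m P Q eq = trans (take-drop m j P) (trans (cong (drop j) eq) (sym (take-drop m j Q)))

  drop-++-≤ : ∀ i (p q : List A) → i ≤ length p → drop i (p ++ q) ≡ drop i p ++ q
  drop-++-≤ zero    p       q _        = refl
  drop-++-≤ (suc i) (_ ∷ p) q (s≤s le) = drop-++-≤ i p q le

  split-last : (p : List A) → 0 < length p → ∃[ q ] ∃[ c ] (p ≡ q ++ [ c ])
  split-last p 0<p with initLast p
  ... | q ∷ʳ′ c = q , c , refl

  suffix-++ : ∀ (p v : List A) j → length v ≤ j → drop (length (p ++ v) ∸ j) (p ++ v) ≡ drop (length (p ++ v) ∸ j) p ++ v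
  suffix-++ p v j v≤j = drop-++-≤ _ p v (subst (λ m → m ∸ j ≤ length p) (sym (length-++ p))
    (≤-trans (∸-monoʳ-≤ (length p + length v) v≤j) (≤-reflexive (m+n∸n≡m (length p) (length v)))))

  last-letters-differ : ∀ {c d : A} (p q w : List A) → c ≢ d → p ++ c ∷ w ≢ q ++ d ∷ w
  last-letters-differ {c = c} {d} p q w c≢d eq =
    c≢d (∷ʳ-injectiveʳ p q (++-cancelʳ w (p ++ [ c ]) (q ++ [ d ]) (trans (∷ʳ-++ p c w) (trans eq (sym (∷ʳ-++ q d w))))))

unique-map-injective : ∀ {a b} {A : Set a} {B : Set b} {f : A → B} {ys : List A} → Unique (map f ys) →
                       ∀ {u v} → u ∈ ys → v ∈ ys → f u ≡ f v → u ≡ v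
unique-map-injective _                (here refl) (here refl) _ = refl
unique-map-injective {f = f} (h ∷ _) (here refl) (there v∈) e = ⊥-elim (All.lookup h (∈-map⁺ f v∈) e)
unique-map-injective {f = f} (h ∷ _) (there u∈) (here refl) e = ⊥-elim (All.lookup h (∈-map⁺ f u∈) (sym e))
unique-map-injective (_ ∷ u)          (there u∈) (there v∈) e = unique-map-injective u u∈ v∈ e

module _ {s} (x : Word s) where

  length-window : ∀ i m → length (window x i m) ≡ m
  length-window i zero    = refl
  length-window i (suc m) = cong suc (length-window (suc i) m)

  window-+ : ∀ i a b → window x i (a + b) ≡ window x i a ++ window x (i + a) b
  window-+ i zero    b = cong (λ j → window x j b) (sym (+-identityʳ i))
  window-+ i (suc a) b = cong (x i ∷_)
    (trans (window-+ (suc i) a b) (cong (λ j → window x (suc i) a ++ window x j b) (sym (+-suc i a))))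

  factor-++ : ∀ (A B : FWord s) → Factor x (A ++ B) →
              ∃[ i ] (window x i (length A) ≡ A × window x (i + length A) (length B) ≡ B)
  factor-++ A B (i , e) = i , ++-injective-length _ A _ B (length-window i (length A)) split
    where
    split : window x i (length A) ++ window x (i + length A) (length B) ≡ A ++ B
    split = trans (sym (window-+ i (length A) (length B))) (trans (cong (window x i) (sym (length-++ A))) e)

  factor-++ˡ : ∀ (A B : FWord s) → Factor x (A ++ B) → Factor x A
  factor-++ˡ A B f with i , eA , _ ← factor-++ A B f = i , eA

  factor-++ʳ : ∀ (A B : FWord s) → Factor x (A ++ B) → Factor x B
  factor-++ʳ A B f with i , _ , eB ← factor-++ A B f = i + length A , eB

  factor-infix : ∀ (A B C : FWord s) → Factor x (A ++ B ++ C) → Factor x B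
  factor-infix A B C f = factor-++ˡ B C (factor-++ʳ A (B ++ C) f)

  rightSpecial-drop : ∀ i (A : FWord s) → RightSpecial x A → RightSpecial x (drop i A)
  rightSpecial-drop i A (c , d , c≢d , fc , fd) = c , d , c≢d , suffix fc , suffix fd
    where
    suffix : ∀ {e} → Factor x (A ++ [ e ]) → Factor x (drop i A ++ [ e ])
    suffix {e} f = factor-++ʳ (take i A) (drop i A ++ [ e ])
      (subst (Factor x) (trans (cong (_++ [ e ]) (sym (take++drop≡id i A))) (++-assoc (take i A) (drop i A) [ e ])) f)

  head-drop-window : ∀ i m N → m < N → ∃[ t ] (drop m (window x i N) ≡ x (i + m) ∷ t)
  head-drop-window i zero    (suc N) _        = window x (suc i) N , cong (λ j → x j ∷ window x (suc i) N) (sym (+-identityʳ i))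
  head-drop-window i (suc m) (suc N) (s≤s lt) with t , eq ← head-drop-window (suc i) m N lt =
    t , trans eq (cong (λ j → x j ∷ t) (sym (+-suc i m)))

module _ {s} (x : Word s) where

  open import Data.List.Membership.DecPropositional (≡-dec (Fin._≟_ {s})) using (_∈?_)

  FactorOfLength : ℕ → FWord s → Set
  FactorOfLength j u = length u ≡ j × Factor x u

  DistinctFactors : ℕ → List (FWord s) → Set
  DistinctFactors j L = Unique L × All (FactorOfLength j) L

  RightSpecialOfLength : ℕ → FWord s → Set
  RightSpecialOfLength j r = length r ≡ j × RightSpecial x r

  PrefixInjective : ℕ → List (FWord s) → Set
  PrefixInjective j Y = ∀ {u v} → u ∈ Y → v ∈ Y → take j u ≡ take j v → u ≡ v

  take-window : ∀ i a → take a (window x i (suc a)) ≡ window x i a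
  take-window i zero    = refl
  take-window i (suc a) = cong (x i ∷_) (take-window (suc i) a)

  rightExtensions : ∀ {j} (L : List (FWord s)) → All (FactorOfLength j) L → List (FWord s)
  rightExtensions []      []                    = []
  rightExtensions {j} (_ ∷ L) ((_ , i , _) ∷ fs) = window x i (suc j) ∷ rightExtensions L fs

  take-rightExtensions : ∀ {j} (L : List (FWord s)) (fs : All (FactorOfLength j) L) →
                         map (take j) (rightExtensions L fs) ≡ L
  take-rightExtensions []      []                       = refl
  take-rightExtensions {j} (_ ∷ L) ((refl , i , e) ∷ fs) =
    cong₂ _∷_ (trans (take-window i j) e) (take-rightExtensions L fs)

  rightExtensions-factors : ∀ {j} (L : List (FWord s)) (fs : All (FactorOfLength j) L) →
                            All (FactorOfLength (suc j)) (rightExtensions L fs)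
  rightExtensions-factors []      []                    = []
  rightExtensions-factors {j} (_ ∷ L) ((_ , i , _) ∷ fs) =
    (length-window x i (suc j) , i , cong (window x i) (length-window x i (suc j))) ∷ rightExtensions-factors L fs

  freshExtension : ∀ {j} {Y : List (FWord s)} → PrefixInjective j Y →
                   ∀ {r} → RightSpecialOfLength j r → ∃[ e ] (take j e ≡ r × e ∉ Y × FactorOfLength (suc j) e)
  freshExtension {Y = Y} injective {r} (refl , c , d , c≢d , fc , fd) with (r ++ [ c ]) ∈? Y
  ... | no c∉Y  = r ++ [ c ] , take-++-length r [ c ] , c∉Y , length-snoc r c , fc
  ... | yes c∈Y = r ++ [ d ] , take-++-length r [ d ] , d∉Y , length-snoc r d , fd
    where
    d∉Y : r ++ [ d ] ∉ Y
    d∉Y d∈Y = c≢d (∷ʳ-injectiveʳ r r (injective c∈Y d∈Y (trans (take-++-length r [ c ]) (sym (take-++-length r [ d ])))))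

  freshExtensions : ∀ {j} {Y : List (FWord s)} → PrefixInjective j Y →
                    (rs : List (FWord s)) → All (RightSpecialOfLength j) rs →
                    ∃[ es ] (map (take j) es ≡ rs × All (_∉ Y) es × All (FactorOfLength (suc j)) es)
  freshExtensions injective []       []         = [] , refl , [] , []
  freshExtensions injective (r ∷ rs) (rsr ∷ rss)
    with e , te , e∉Y , fe ← freshExtension injective rsr
       | es , tes , es∉Y , fes ← freshExtensions injective rs rss
    = e ∷ es , cong₂ _∷_ te tes , e∉Y ∷ es∉Y , fe ∷ fes

  distinctFactors-grow : ∀ {j L} → DistinctFactors j L →
                         (rs : List (FWord s)) → Unique rs → All (RightSpecialOfLength j) rs →
                         ∃[ L′ ] (DistinctFactors (suc j) L′ × length rs + length L ≤ length L′)
  distinctFactors-grow {j} {L} (uL , fL) rs urs rss =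
    es ++ Y , (Unique.++⁺ ues uY disjoint , All.++⁺ fes (rightExtensions-factors L fL)) , ≤-reflexive count
    where
    Y = rightExtensions L fL
    uY′ : Unique (map (take j) Y)
    uY′ = subst Unique (sym (take-rightExtensions L fL)) uL
    uY : Unique Y
    uY = Unique.map⁻ uY′
    injective : PrefixInjective j Y
    injective = unique-map-injective uY′
    fresh = freshExtensions injective rs rss
    es = proj₁ fresh
    tes = proj₁ (proj₂ fresh)
    es∉Y = proj₁ (proj₂ (proj₂ fresh))
    fes = proj₂ (proj₂ (proj₂ fresh))
    ues : Unique es
    ues = Unique.map⁻ (subst Unique (sym tes) urs)
    disjoint : ∀ {v} → ¬ (v ∈ es × v ∈ Y)
    disjoint (v∈es , v∈Y) = All.lookup es∉Y v∈es v∈Y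
    count : length rs + length L ≡ length (es ++ Y)
    count = sym (begin
      length (es ++ Y)                              ≡⟨ length-++ es ⟩
      length es + length Y                          ≡⟨ cong₂ _+_ (trans (sym (length-map (take j) es)) (cong length tes))
                                                                 (trans (sym (length-map (take j) Y)) (cong length (take-rightExtensions L fL))) ⟩
      length rs + length L                          ∎)
      where open ≡-Reasoning

  distinctFactors-fromRightSpecials : ∀ m → (∀ j → j < m → ∃ (RightSpecialOfLength j)) →
                                      ∃[ L ] (DistinctFactors m L × suc m ≤ length L)
  distinctFactors-fromRightSpecials zero    _  = [] ∷ [] , ([] ∷ [] , (refl , 0 , refl) ∷ []) , ≤-refl
  distinctFactors-fromRightSpecials (suc m) rs
    with L , dL , m<L ← distinctFactors-fromRightSpecials m (λ j j<m → rs j (m<n⇒m<1+n j<m))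
       | r , rsr ← rs m ≤-refl
    with L′ , dL′ , L<L′ ← distinctFactors-grow dL [ r ] ([] ∷ []) (rsr ∷ [])
    = L′ , dL′ , ≤-trans (s≤s m<L) L<L′

  distinctFactors-fromRightSpecialPairs :
    ∀ {m L} D → DistinctFactors m L →
    (∀ t → t < D → ∃[ r ] ∃[ r′ ] (r ≢ r′ × RightSpecialOfLength (m + t) r × RightSpecialOfLength (m + t) r′)) →
    ∃[ L′ ] (DistinctFactors (m + D) L′ × 2 * D + length L ≤ length L′)
  distinctFactors-fromRightSpecialPairs {m} {L} zero dL _ = L , subst (λ j → DistinctFactors j L) (sym (+-identityʳ m)) dL , ≤-refl
  distinctFactors-fromRightSpecialPairs {m} {L} (suc D) dL pairs
    with L₁ , dL₁ , L≤L₁ ← distinctFactors-fromRightSpecialPairs D dL (λ t t<D → pairs t (m<n⇒m<1+n t<D))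
       | r , r′ , r≢r′ , rsr , rsr′ ← pairs D ≤-refl
    with L₂ , dL₂ , L₁≤L₂ ← distinctFactors-grow dL₁ (r ∷ r′ ∷ []) ((r≢r′ ∷ []) ∷ [] ∷ []) (rsr ∷ rsr′ ∷ [])
    = L₂ , subst (λ j → DistinctFactors j L₂) (sym (+-suc m D)) dL₂ , ≤-trans (≤-reflexive (count D (length L))) (≤-trans (s≤s (s≤s L≤L₁)) L₁≤L₂)
    where
    count : ∀ D l → 2 * suc D + l ≡ 2 + (2 * D + l)
    count = solve-∀

  rightSpecial-suffix : ∀ {A} j → j ≤ length A → RightSpecial x A → RightSpecialOfLength j (drop (length A ∸ j) A)
  rightSpecial-suffix {A} j j≤A rs = trans (length-drop (length A ∸ j) A) (m∸[m∸n]≡n j≤A) , rightSpecial-drop x (length A ∸ j) A rs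

complexity-arith : ∀ n D L → 2 * D + suc (suc n) ≤ L → L * 3 ≤ 4 * (suc n + D) → 2 * D + 2 ≤ n
complexity-arith n D L many few = +-cancelˡ-≤ (4 * (suc n + D)) _ _ (begin
  4 * (suc n + D) + (2 * D + 2)  ≡⟨ identity n D ⟨
  (2 * D + suc (suc n)) * 3 + n  ≤⟨ +-monoˡ-≤ n (*-monoˡ-≤ 3 many) ⟩
  L * 3 + n                      ≤⟨ +-monoˡ-≤ n few ⟩
  4 * (suc n + D) + n            ∎)
  where
  open ≤-Reasoning
  identity : ∀ n D → (2 * D + suc (suc n)) * 3 + n ≡ 4 * (suc n + D) + (2 * D + 2)
  identity = solve-∀

module _ {a} {A : Set a} (f : ℕ → A) where

  Periodic : ℕ → ℕ → Set a
  Periodic p N = ∀ i → i + p < N → f i ≡ f (i + p)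

  periodic-≤ : ∀ {p M N} → M ≤ N → Periodic p N → Periodic p M
  periodic-≤ M≤N per i lt = per i (<-≤-trans lt M≤N)

  periodic-sum-short : ∀ {p d N} → Periodic p N → Periodic (p + d) N → ∀ i → i + (p + d) < N → f i ≡ f (i + d)
  periodic-sum-short {p} {d} {N} per-p per-q i lt =
    trans (per-q i lt) (sym (trans (per-p (i + d) (subst (_< N) (sym (reorder i d p)) lt)) (cong f (reorder i d p))))
    where
    reorder : ∀ i d p → i + d + p ≡ i + (p + d)
    reorder = solve-∀

  periodic-sum-far : ∀ {p d N} → Periodic p N → Periodic (p + d) N → ∀ j → p + j + d < N → f (p + j) ≡ f (p + j + d)
  periodic-sum-far {p} {d} {N} per-p per-q j lt = begin
    f (p + j)        ≡⟨ cong f (+-comm p j) ⟩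
    f (j + p)        ≡⟨ per-p j (≤-<-trans (≤-trans (≤-reflexive (+-comm j p)) (m≤m+n (p + j) d)) lt) ⟨
    f j              ≡⟨ per-q j (subst (_< N) (reorder p j d) lt) ⟩
    f (j + (p + d))  ≡⟨ cong f (sym (reorder p j d)) ⟩
    f (p + j + d)    ∎
    where
    open ≡-Reasoning
    reorder : ∀ p j d → p + j + d ≡ j + (p + d)
    reorder = solve-∀

  -- Euclid's step of the Fine–Wilf theorem.  The only position not handled by the two cases
  -- above is i = p − 1 when N = 2p + d − 1; there the prefix of length p + d − 1 has the
  -- periods p and d, and recursing on that pair compares f (p − 1) with f (d − 1).
  periodic-difference : ∀ p d N → Acc _<_ (p + d) → 0 < p → p + (p + d) ≤ suc N →
                        Periodic p N → Periodic (p + d) N → Periodic d N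
  periodic-difference p zero N _ _ _ _ _ i _ = cong f (sym (+-identityʳ i))
  periodic-difference (suc p′) (suc d′) N (acc rec) _ bound per-p per-q i i+d<N
    with i + (suc p′ + suc d′) <? N | suc p′ ≤? i
  ... | yes short | _       = periodic-sum-short per-p per-q i short
  ... | no _      | yes p≤i with j , refl ← m≤n⇒∃[o]m+o≡n p≤i = periodic-sum-far per-p per-q j i+d<N
  ... | no long   | no i≱p  = subst (λ k → f k ≡ f (k + d)) (sym i≡p′) corner
    where
    p = suc p′
    d = suc d′
    N′ = p + d′
    arith₁ : ∀ p′ d′ → suc p′ + (suc p′ + suc d′) ≡ suc ((suc p′ + d′) + suc p′)
    arith₁ = solve-∀
    arith₂ : ∀ p′ d′ → d′ + suc p′ ≡ p′ + suc d′
    arith₂ = solve-∀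
    i≡p′ : i ≡ p′
    i≡p′ = ≤-antisym (s≤s⁻¹ (≰⇒> i≱p))
      (s≤s⁻¹ (+-cancelʳ-≤ (p + d) p (suc i) (≤-trans bound (s≤s (≮⇒≥ long)))))
    room : N′ + p ≤ N
    room = s≤s⁻¹ (subst (_≤ suc N) (arith₁ p′ d′) bound)
    per-p′ : Periodic p N′
    per-p′ = periodic-≤ (≤-trans (m≤m+n N′ p) room) per-p
    per-d′ : Periodic d N′
    per-d′ j lt = periodic-sum-short per-p per-q j
      (subst (_< N) (trans (+-assoc j d p) (cong (j +_) (+-comm d p))) (<-≤-trans (+-monoˡ-< p lt) room))
    d′<N′ : d′ < N′
    d′<N′ = m<n+m d′ z<s
    p′<N′ : p′ < N′
    p′<N′ = ≤-trans (n<1+n p′) (m≤m+n p d′)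
    f-p′≡f-d′ : f p′ ≡ f d′
    f-p′≡f-d′ with ≤-total p d
    ... | inj₁ p≤d with e , p+e≡d ← m≤n⇒∃[o]m+o≡n p≤d =
      trans (per-e p′ (subst (_< N′) (sym p′+e≡d′) d′<N′)) (cong f p′+e≡d′)
      where
      p′+e≡d′ : p′ + e ≡ d′
      p′+e≡d′ = suc-injective p+e≡d
      per-e : Periodic e N′
      per-e = periodic-difference p e N′ (rec (subst (_< p + d) (sym p+e≡d) (m<n+m d z<s))) z<s
        (subst (λ q → p + q ≤ suc N′) (sym p+e≡d) (≤-reflexive (+-suc p d′)))
        per-p′ (subst (λ q → Periodic q N′) (sym p+e≡d) per-d′)
    ... | inj₂ d≤p with e , d+e≡p ← m≤n⇒∃[o]m+o≡n d≤p =
      sym (trans (per-e d′ (subst (_< N′) (sym d′+e≡p′) p′<N′)) (cong f d′+e≡p′))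
      where
      d′+e≡p′ : d′ + e ≡ p′
      d′+e≡p′ = suc-injective d+e≡p
      per-e : Periodic e N′
      per-e = periodic-difference d e N′ (rec (subst (_< p + d) (sym d+e≡p) (m<m+n p z<s))) z<s
        (subst (λ q → d + q ≤ suc N′) (sym d+e≡p) (≤-reflexive (trans (+-comm d p) (+-suc p d′))))
        per-d′ (subst (λ q → Periodic q N′) (sym d+e≡p) per-p′)
    corner : f p′ ≡ f (p′ + d)
    corner = begin
      f p′           ≡⟨ f-p′≡f-d′ ⟩
      f d′           ≡⟨ per-p d′ (<-≤-trans (+-monoˡ-< p d′<N′) room) ⟩
      f (d′ + p)     ≡⟨ cong f (arith₂ p′ d′) ⟩
      f (p′ + d)     ∎
      where open ≡-Reasoning

module ReturnPaths {s} (x : Word s) (n : ℕ) (w : FWord s) (∣w∣≡n : length w ≡ n)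
  (special⇒w : ∀ (u : FWord s) → length u ≡ n → Factor x u → LeftSpecial x u ⊎ RightSpecial x u → u ≡ w) where

  rightExtension-unique : ∀ {u c d} → length u ≡ n → u ≢ w → Factor x (u ++ [ c ]) → Factor x (u ++ [ d ]) → c ≡ d
  rightExtension-unique {u} {c} {d} ∣u∣ u≢w fc fd with c Fin.≟ d
  ... | yes c≡d = c≡d
  ... | no  c≢d = ⊥-elim (u≢w (special⇒w u ∣u∣ (factor-++ˡ x u [ c ] fc) (inj₂ (c , d , c≢d , fc , fd))))

  leftExtension-unique : ∀ {u c d} → length u ≡ n → u ≢ w → Factor x (c ∷ u) → Factor x (d ∷ u) → c ≡ d
  leftExtension-unique {u} {c} {d} ∣u∣ u≢w fc fd with c Fin.≟ d
  ... | yes c≡d = c≡d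
  ... | no  c≢d = ⊥-elim (u≢w (special⇒w u ∣u∣ (factor-++ʳ x [ c ] u fc) (inj₁ (c , d , c≢d , fc , fd))))

  module Return {P : FWord s} (rP : ReturnPath x n w P) where

    k : ℕ
    k = pathLen n P

    length≡ : length P ≡ k + n
    length≡ = sym (m∸n+n≡m (proj₁ (proj₁ rP)))

    0<k : 0 < k
    0<k = proj₁ (proj₂ rP)

    start : take n P ≡ w
    start = proj₁ (proj₂ (proj₂ rP))

    split-start : P ≡ w ++ drop n P
    split-start = trans (sym (take++drop≡id n P)) (cong (_++ drop n P) start)

    end : drop k P ≡ w
    end = proj₁ (proj₂ (proj₂ (proj₂ rP)))

    edge : ∀ j → j + suc n ≤ length P → Factor x (take (suc n) (drop j P))
    edge = proj₂ (proj₂ (proj₁ rP))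

    interior : ∀ j → 0 < j → j < k → take n (drop j P) ≢ w
    interior = proj₂ (proj₂ (proj₂ (proj₂ rP)))

    interior-vertex : ∀ j → 0 < j → j < k → length (take n (drop j P)) ≡ n × take n (drop j P) ≢ w
    interior-vertex j 0<j j<k = length-take-drop j n P (subst (j + n ≤_) (sym length≡) (+-monoˡ-≤ n (<⇒≤ j<k))) , interior j 0<j j<k

  private
    take-length≡ : ∀ {P} (rP : ReturnPath x n w P) → take (Return.k rP + n) P ≡ P
    take-length≡ {P} rP = take-all (Return.k rP + n) P (≤-reflexive (Return.length≡ rP))

    take-w : take n w ≡ w
    take-w = take-all n w (≤-reflexive ∣w∣≡n)

  prefix-step : ∀ {P Q} (rP : ReturnPath x n w P) (rQ : ReturnPath x n w Q) →
                ∀ j → 0 < j → j < Return.k rP → j < Return.k rQ →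
                take (j + n) P ≡ take (j + n) Q → take (suc j + n) P ≡ take (suc j + n) Q
  prefix-step {P} {Q} rP rQ j 0<j j<kP j<kQ agree = begin
    take (suc (j + n)) P     ≡⟨ take-suc-∷ʳ (j + n) P (proj₂ (next rP j<kP)) ⟩
    take (j + n) P ++ [ a ]  ≡⟨ cong₂ (λ u c → u ++ [ c ]) agree a≡b ⟩
    take (j + n) Q ++ [ b ]  ≡⟨ take-suc-∷ʳ (j + n) Q (proj₂ (next rQ j<kQ)) ⟨
    take (suc (j + n)) Q     ∎
    where
    open ≡-Reasoning
    next : ∀ {R} (rR : ReturnPath x n w R) → j < Return.k rR → ∃[ e ] (drop (j + n) R ≡ e ∷ drop (suc (j + n)) R)
    next {R} rR j<k = drop-∷ (j + n) R (subst (j + n <_) (sym (Return.length≡ rR)) (+-monoˡ-< n j<k))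
    a = proj₁ (next rP j<kP)
    b = proj₁ (next rQ j<kQ)
    outgoing : ∀ {R} (rR : ReturnPath x n w R) (j<k : j < Return.k rR) →
               Factor x (take n (drop j R) ++ [ proj₁ (next rR j<k) ])
    outgoing {R} rR j<k = subst (Factor x)
      (take-suc-∷ʳ n (drop j R) (trans (drop-drop j n R) (proj₂ (next rR j<k))))
      (Return.edge rR j (subst₂ _≤_ (sym (+-suc j n)) (sym (Return.length≡ rR)) (+-monoˡ-≤ n j<k)))
    a≡b : a ≡ b
    a≡b = rightExtension-unique (proj₁ (Return.interior-vertex rP j 0<j j<kP)) (proj₂ (Return.interior-vertex rP j 0<j j<kP))
      (outgoing rP j<kP)
      (subst (λ u → Factor x (u ++ [ b ])) (sym (window-of-prefix j n P Q agree)) (outgoing rQ j<kQ))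

  prefixes-agree : ∀ {P Q} (rP : ReturnPath x n w P) (rQ : ReturnPath x n w Q) → take (suc n) P ≡ take (suc n) Q →
                   ∀ j → 0 < j → j ≤ Return.k rP → j ≤ Return.k rQ → take (j + n) P ≡ take (j + n) Q
  prefixes-agree rP rQ first (suc zero)    _ _  _  = first
  prefixes-agree rP rQ first (suc (suc j)) _ jP jQ =
    prefix-step rP rQ (suc j) z<s jP jQ (prefixes-agree rP rQ first (suc j) z<s (<⇒≤ jP) (<⇒≤ jQ))

  ≡-of-common-prefix : ∀ {P Q} (rP : ReturnPath x n w P) (rQ : ReturnPath x n w Q) → Return.k rP ≤ Return.k rQ →
                       take (Return.k rP + n) P ≡ take (Return.k rP + n) Q → P ≡ Q
  ≡-of-common-prefix {P} {Q} rP rQ kP≤kQ agree with m≤n⇒m<n∨m≡n kP≤kQ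
  ... | inj₂ kP≡kQ = trans (sym (take-length≡ rP)) (trans agree (subst (λ m → take (m + n) Q ≡ Q) (sym kP≡kQ) (take-length≡ rQ)))
  ... | inj₁ kP<kQ = ⊥-elim (Return.interior rQ (Return.k rP) (Return.0<k rP) kP<kQ (begin
    take n (drop (Return.k rP) Q)  ≡⟨ window-of-prefix (Return.k rP) n P Q agree ⟨
    take n (drop (Return.k rP) P)  ≡⟨ cong (take n) (Return.end rP) ⟩
    take n w                       ≡⟨ take-w ⟩
    w                              ∎))
    where open ≡-Reasoning

  determined-by-first-edge : ∀ {P Q} → ReturnPath x n w P → ReturnPath x n w Q → take (suc n) P ≡ take (suc n) Q → P ≡ Q
  determined-by-first-edge rP rQ first with ≤-total (Return.k rP) (Return.k rQ)
  ... | inj₁ kP≤kQ = ≡-of-common-prefix rP rQ kP≤kQ (prefixes-agree rP rQ first (Return.k rP) (Return.0<k rP) ≤-refl kP≤kQ)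
  ... | inj₂ kQ≤kP =
    sym (≡-of-common-prefix rQ rP kQ≤kP (prefixes-agree rQ rP (sym first) (Return.k rQ) (Return.0<k rQ) ≤-refl kQ≤kP))

  determined-by-first-letter : ∀ {P Q c tP tQ} → ReturnPath x n w P → ReturnPath x n w Q →
                               P ≡ w ++ c ∷ tP → Q ≡ w ++ c ∷ tQ → P ≡ Q
  determined-by-first-letter rP rQ refl refl = determined-by-first-edge rP rQ (trans first-edge (sym first-edge))
    where
    first-edge : ∀ {c t} → take (suc n) (w ++ c ∷ t) ≡ w ++ [ c ]
    first-edge {c} {t} = subst (λ m → take (suc m) (w ++ c ∷ t) ≡ w ++ [ c ]) ∣w∣≡n (take-suc-++-length w c t)

  suffix-step : ∀ {P Q} (rP : ReturnPath x n w P) (rQ : ReturnPath x n w Q) →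
                ∀ a a′ j → 0 < j → suc a + j ≡ Return.k rP → suc a′ + j ≡ Return.k rQ →
                drop (suc a) P ≡ drop (suc a′) Q → drop a P ≡ drop a′ Q
  suffix-step {P} {Q} rP rQ a a′ j 0<j aP aQ agree = begin
    drop a P                ≡⟨ proj₂ (previous rP aP) ⟩
    e ∷ drop (suc a) P      ≡⟨ cong₂ _∷_ e≡e′ agree ⟩
    e′ ∷ drop (suc a′) Q    ≡⟨ proj₂ (previous rQ aQ) ⟨
    drop a′ Q               ∎
    where
    open ≡-Reasoning
    previous : ∀ {R b} (rR : ReturnPath x n w R) → suc b + j ≡ Return.k rR → ∃[ e ] (drop b R ≡ e ∷ drop (suc b) R)
    previous {R} {b} rR eq = drop-∷ b R (subst (b <_) (sym (Return.length≡ rR)) (≤-trans (m≤m+n (suc b) j) (≤-trans (≤-reflexive eq) (m≤m+n _ n))))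
    e = proj₁ (previous rP aP)
    e′ = proj₁ (previous rQ aQ)
    incoming : ∀ {R b} (rR : ReturnPath x n w R) (eq : suc b + j ≡ Return.k rR) →
               Factor x (proj₁ (previous rR eq) ∷ take n (drop (suc b) R))
    incoming {R} {b} rR eq = subst (Factor x) (cong (take (suc n)) (proj₂ (previous rR eq)))
      (Return.edge rR b (subst₂ _≤_ (sym (+-suc b n)) (sym (Return.length≡ rR))
        (+-monoˡ-≤ n (≤-trans (m≤m+n (suc b) j) (≤-reflexive eq)))))
    suc-a<kP : suc a < Return.k rP
    suc-a<kP = subst (suc a <_) aP (m<m+n (suc a) 0<j)
    e≡e′ : e ≡ e′
    e≡e′ = leftExtension-unique (proj₁ (Return.interior-vertex rP (suc a) z<s suc-a<kP))
      (proj₂ (Return.interior-vertex rP (suc a) z<s suc-a<kP))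
      (incoming rP aP)
      (subst (λ u → Factor x (e′ ∷ take n u)) (sym agree) (incoming rQ aQ))

  suffixes-agree : ∀ {P Q} (rP : ReturnPath x n w P) (rQ : ReturnPath x n w Q) →
                   (∀ a a′ → suc a ≡ Return.k rP → suc a′ ≡ Return.k rQ → drop a P ≡ drop a′ Q) →
                   ∀ j a a′ → 0 < j → a + j ≡ Return.k rP → a′ + j ≡ Return.k rQ → drop a P ≡ drop a′ Q
  suffixes-agree rP rQ last (suc zero) a a′ _ aP aQ =
    last a a′ (trans (+-comm 1 a) aP) (trans (+-comm 1 a′) aQ)
  suffixes-agree rP rQ last (suc (suc j)) a a′ _ aP aQ =
    suffix-step rP rQ a a′ (suc j) z<s (trans (sym (+-suc a (suc j))) aP) (trans (sym (+-suc a′ (suc j))) aQ)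
      (suffixes-agree rP rQ last (suc j) (suc a) (suc a′) z<s (trans (sym (+-suc a (suc j))) aP) (trans (sym (+-suc a′ (suc j))) aQ))

  ≡-of-common-suffix : ∀ {P Q} (rP : ReturnPath x n w P) (rQ : ReturnPath x n w Q) →
                       ∀ a′ → a′ + Return.k rP ≡ Return.k rQ → P ≡ drop a′ Q → P ≡ Q
  ≡-of-common-suffix rP rQ zero      _  agree = agree
  ≡-of-common-suffix {P} {Q} rP rQ (suc a′) aQ agree = ⊥-elim (Return.interior rQ (suc a′) z<s
    (subst (suc a′ <_) aQ (m<m+n (suc a′) (Return.0<k rP)))
    (trans (cong (take n) (sym agree)) (Return.start rP)))

  last-edge : ∀ {R p c} (rR : ReturnPath x n w R) → R ≡ p ++ c ∷ w → ∀ a → suc a ≡ Return.k rR → drop a R ≡ c ∷ w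
  last-edge {R} {p} {c} rR refl a eq = subst (λ b → drop b R ≡ c ∷ w) ∣p∣≡a (drop-++-length p (c ∷ w))
    where
    open ≡-Reasoning
    ∣p∣≡a : length p ≡ a
    ∣p∣≡a = suc-injective (+-cancelʳ-≡ n _ _ (begin
      suc (length p) + n     ≡⟨ +-suc (length p) n ⟨
      length p + suc n       ≡⟨ cong (λ m → length p + suc m) ∣w∣≡n ⟨
      length p + length (c ∷ w) ≡⟨ length-++ p ⟨
      length R               ≡⟨ Return.length≡ rR ⟩
      Return.k rR + n        ≡⟨ cong (_+ n) eq ⟨
      suc a + n              ∎))

  determined-by-last-letter : ∀ {P Q c pP pQ} → ReturnPath x n w P → ReturnPath x n w Q →
                              P ≡ pP ++ c ∷ w → Q ≡ pQ ++ c ∷ w → P ≡ Q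
  determined-by-last-letter {P} {Q} {c} rP rQ eP eQ with ≤-total (Return.k rP) (Return.k rQ)
  ... | inj₁ kP≤kQ = ≡-of-common-suffix rP rQ _ gap
        (suffixes-agree rP rQ (λ a a′ aP aQ → trans (last-edge rP eP a aP) (sym (last-edge rQ eQ a′ aQ)))
                        (Return.k rP) 0 _ (Return.0<k rP) refl gap)
    where gap = trans (+-comm _ (Return.k rP)) (proj₂ (m≤n⇒∃[o]m+o≡n kP≤kQ))
  ... | inj₂ kQ≤kP = sym (≡-of-common-suffix rQ rP _ gap
        (suffixes-agree rQ rP (λ a a′ aQ aP → trans (last-edge rQ eQ a aQ) (sym (last-edge rP eP a′ aP)))
                        (Return.k rQ) 0 _ (Return.0<k rQ) refl gap))
    where gap = trans (+-comm _ (Return.k rQ)) (proj₂ (m≤n⇒∃[o]m+o≡n kQ≤kP))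

  record Loop (P : FWord s) : Set where
    field
      out      : Fin s
      outRest  : FWord s
      front    : FWord s
      into     : Fin s
      after-w  : P ≡ w ++ out ∷ outRest
      before-w : P ≡ front ++ into ∷ w

  loop : ∀ {P} → ReturnPath x n w P → Loop P
  loop {P} rP = record
    { out = proj₁ first ; outRest = drop (suc n) P ; front = proj₁ last ; into = proj₁ (proj₂ last)
    ; after-w  = trans (Return.split-start rP) (cong (w ++_) (proj₂ first))
    ; before-w = trans (sym (take++drop≡id k P))
                       (trans (cong₂ _++_ (proj₂ (proj₂ last)) (Return.end rP)) (++-assoc (proj₁ last) _ w))
    }
    where
    k = Return.k rP
    first = drop-∷ n P (subst (n <_) (sym (Return.length≡ rP)) (m<n+m n (Return.0<k rP)))
    ∣take-k∣ : length (take k P) ≡ k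
    ∣take-k∣ = length-take-≤ k P (subst (k ≤_) (sym (Return.length≡ rP)) (m≤m+n k n))
    last = split-last (take k P) (subst (0 <_) (sym ∣take-k∣) (Return.0<k rP))

  module _ (i₀ : ℕ) (w≡window : w ≡ window x i₀ n) where

    letter : ℕ → Fin s
    letter i = x (i₀ + i)

    drop-end : ∀ {P} (rP : ReturnPath x n w P) → ∀ i → i < n → ∃[ t ] (drop (Return.k rP + i) P ≡ letter i ∷ t)
    drop-end {P} rP i i<n with t , eq ← head-drop-window x i₀ i n i<n =
      t , trans (sym (drop-drop (Return.k rP) i P)) (trans (cong (drop i) (trans (Return.end rP) w≡window)) eq)

    returnPath-period : ∀ {P} (rP : ReturnPath x n w P) → Periodic letter (Return.k rP) n
    returnPath-period {P} rP i i+k<n = sym (trans (cong letter (+-comm i k)) (∷-injectiveˡ (begin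
      letter (k + i) ∷ t ++ drop n P  ≡⟨ cong (_++ drop n P) eq ⟨
      drop (k + i) w ++ drop n P      ≡⟨ drop-++-≤ (k + i) w (drop n P) (subst (k + i ≤_) (sym ∣w∣≡n) (<⇒≤ k+i<n)) ⟨
      drop (k + i) (w ++ drop n P)    ≡⟨ cong (drop (k + i)) (Return.split-start rP) ⟨
      drop (k + i) P                  ≡⟨ proj₂ (drop-end rP i (≤-<-trans (m≤m+n i k) i+k<n)) ⟩
      letter i ∷ proj₁ (drop-end rP i (≤-<-trans (m≤m+n i k) i+k<n)) ∎)))
      where
      open ≡-Reasoning
      k = Return.k rP
      k+i<n : k + i < n
      k+i<n = subst (_< n) (+-comm i k) i+k<n
      t = proj₁ (head-drop-window x i₀ (k + i) n k+i<n)
      eq : drop (k + i) w ≡ letter (k + i) ∷ t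
      eq = trans (cong (drop (k + i)) w≡window) (proj₂ (head-drop-window x i₀ (k + i) n k+i<n))

    first-letter : ∀ {P} (rP : ReturnPath x n w P) → ∀ a → Return.k rP + a ≡ n → ∃[ t ] (P ≡ w ++ letter a ∷ t)
    first-letter {P} rP a k+a≡n with t , eq ← drop-end rP a (subst (a <_) k+a≡n (m<n+m a (Return.0<k rP))) =
      t , trans (Return.split-start rP) (cong (w ++_) (trans (cong (λ m → drop m P) (sym k+a≡n)) eq))

    -- Fine–Wilf makes k_P − k_Q a period of w, so both paths leave w by the letter w[n − k_P] = w[n − k_Q].
    short-returnPaths-coincide : ∀ {P Q} (rP : ReturnPath x n w P) (rQ : ReturnPath x n w Q) →
                                 Return.k rQ ≤ Return.k rP → Return.k rP + Return.k rQ ≤ suc n → P ≡ Q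
    short-returnPaths-coincide {P} {Q} rP rQ kQ≤kP short =
      determined-by-first-letter rP rQ (proj₂ first-P) (trans (proj₂ first-Q) (cong (λ c → w ++ c ∷ proj₁ first-Q) (sym same-letter)))
      where
      kP = Return.k rP
      kQ = Return.k rQ
      e = proj₁ (m≤n⇒∃[o]m+o≡n kQ≤kP)
      kQ+e≡kP = proj₂ (m≤n⇒∃[o]m+o≡n kQ≤kP)
      kP≤n = s≤s⁻¹ (≤-trans (m<m+n kP (Return.0<k rQ)) short)
      a = proj₁ (m≤n⇒∃[o]m+o≡n kP≤n)
      kP+a≡n = proj₂ (m≤n⇒∃[o]m+o≡n kP≤n)
      regroup : ∀ kQ a e → kQ + (a + e) ≡ kQ + e + a
      regroup = solve-∀
      kQ+a+e≡n : kQ + (a + e) ≡ n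
      kQ+a+e≡n = trans (regroup kQ a e) (trans (cong (_+ a) kQ+e≡kP) kP+a≡n)
      per-e : Periodic letter e n
      per-e = periodic-difference letter kQ e n (<-wellFounded (kQ + e)) (Return.0<k rQ)
        (subst (λ m → kQ + m ≤ suc n) (sym kQ+e≡kP) (subst (_≤ suc n) (+-comm kP kQ) short))
        (returnPath-period rQ) (subst (λ q → Periodic letter q n) (sym kQ+e≡kP) (returnPath-period rP))
      first-P = first-letter rP a kP+a≡n
      first-Q = first-letter rQ (a + e) kQ+a+e≡n
      same-letter : letter a ≡ letter (a + e)
      same-letter = per-e a (subst (a + e <_) kQ+a+e≡n (m<n+m (a + e) (Return.0<k rQ)))

  returnPaths-long : Factor x w → ∀ {P Q} (rP : ReturnPath x n w P) (rQ : ReturnPath x n w Q) → P ≢ Q →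
                     suc (suc n) ≤ Return.k rP + Return.k rQ
  returnPaths-long (i₀ , w-at-i₀) {P} {Q} rP rQ P≢Q = ≮⇒≥ (λ short → P≢Q (coincide (s≤s⁻¹ short)))
    where
    w≡window : w ≡ window x i₀ n
    w≡window = sym (subst (λ m → window x i₀ m ≡ w) ∣w∣≡n w-at-i₀)
    coincide : Return.k rP + Return.k rQ ≤ suc n → P ≡ Q
    coincide short with ≤-total (Return.k rP) (Return.k rQ)
    ... | inj₂ kQ≤kP = short-returnPaths-coincide i₀ w≡window rP rQ kQ≤kP short
    ... | inj₁ kP≤kQ = sym (short-returnPaths-coincide i₀ w≡window rQ rP kP≤kQ
                              (subst (_≤ suc n) (+-comm (Return.k rP) (Return.k rQ)) short))

branch-bound : ∀ {s} (x : Word s) {n} {w : FWord s} → length w ≡ n → RightSpecial x w →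
               (∀ m → n < m → ComplexityRatioAtMost x m 4 3) →
               ∀ {U pU cU} → EssRightSpecial x U → U ≡ pU ++ cU ∷ w →
               ∀ {a c} D → RightSpecial x (a ++ c ∷ w) → c ≢ cU → length (a ++ c ∷ w) ≡ n + D → 2 * D + 2 ≤ n
branch-bound x {n} {w} refl rs-w complexity {U} {pU} {cU} ess refl {a} {c} D rs-A c≢cU ∣A∣ =
  complexity-arith n D (length L₂) (≤-trans (+-monoʳ-≤ (2 * D) L₁-long) L₂-long)
    (complexity (suc n + D) (s≤s (m≤m+n n D)) L₂ (proj₁ dL₂) (proj₂ dL₂))
  where
  A = a ++ c ∷ w
  suffixes-of-w : ∀ j → j < suc n → ∃ (RightSpecialOfLength x j)
  suffixes-of-w j j<sn = _ , rightSpecial-suffix x j (s≤s⁻¹ j<sn) rs-w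
  L₁ = proj₁ (distinctFactors-fromRightSpecials x (suc n) suffixes-of-w)
  dL₁ = proj₁ (proj₂ (distinctFactors-fromRightSpecials x (suc n) suffixes-of-w))
  L₁-long = proj₂ (proj₂ (distinctFactors-fromRightSpecials x (suc n) suffixes-of-w))
  pairs : ∀ t → t < D → ∃[ r ] ∃[ r′ ] (r ≢ r′ × RightSpecialOfLength x (suc n + t) r × RightSpecialOfLength x (suc n + t) r′)
  pairs t t<D with f , f-long , rs-f , y , refl ← ess (suc n + t) =
    _ , _ , distinct , rightSpecial-suffix x j j≤A rs-A , rightSpecial-suffix x j f-long rs-f
    where
    j = suc n + t
    j≤A : j ≤ length A
    j≤A = subst (j ≤_) (sym ∣A∣) (subst (_≤ length w + D) (+-suc (length w) t) (+-monoʳ-≤ (length w) t<D))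
    distinct : drop (length A ∸ j) A ≢ drop (length (y ++ U) ∸ j) (y ++ U)
    distinct eq = last-letters-differ _ _ w c≢cU (begin
      drop (length A ∸ j) a ++ c ∷ w             ≡⟨ suffix-++ a (c ∷ w) j (m≤m+n (suc n) t) ⟨
      drop (length A ∸ j) A                      ≡⟨ eq ⟩
      drop (length (y ++ U) ∸ j) (y ++ U)        ≡⟨ cong (λ v → drop (length v ∸ j) v) (sym (++-assoc y pU (cU ∷ w))) ⟩
      drop (length ((y ++ pU) ++ cU ∷ w) ∸ j) ((y ++ pU) ++ cU ∷ w)
                                                 ≡⟨ suffix-++ (y ++ pU) (cU ∷ w) j (m≤m+n (suc n) t) ⟩
      drop (length ((y ++ pU) ++ cU ∷ w) ∸ j) (y ++ pU) ++ cU ∷ w ∎)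
      where open ≡-Reasoning
  L₂ = proj₁ (distinctFactors-fromRightSpecialPairs x D dL₁ pairs)
  dL₂ = proj₁ (proj₂ (distinctFactors-fromRightSpecialPairs x D dL₁ pairs))
  L₂-long = proj₂ (proj₂ (distinctFactors-fromRightSpecialPairs x D dL₁ pairs))

length-bound-arith : ∀ t′ ℓ n k → 2 * (suc t′ * ℓ) + 2 ≤ n → suc (suc n) ≤ k + ℓ → (2 * suc (suc t′) ∸ 3) * ℓ + 4 ≤ k
length-bound-arith t′ ℓ n k short long = +-cancelʳ-≤ ℓ _ k (begin
  (2 * suc (suc t′) ∸ 3) * ℓ + 4 + ℓ  ≡⟨ cong (λ m → m * ℓ + 4 + ℓ) (trans (cong (_∸ 3) (double t′)) (m+n∸m≡n 3 (suc (2 * t′)))) ⟩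
  suc (2 * t′) * ℓ + 4 + ℓ            ≡⟨ regroup t′ ℓ ⟩
  2 * (suc t′ * ℓ) + 2 + 2            ≤⟨ +-monoˡ-≤ 2 short ⟩
  n + 2                               ≡⟨ +-comm n 2 ⟩
  suc (suc n)                         ≤⟨ long ⟩
  k + ℓ                               ∎)
  where
  open ≤-Reasoning
  double : ∀ t′ → 2 * suc (suc t′) ≡ 3 + suc (2 * t′)
  double = solve-∀
  regroup : ∀ t′ ℓ → suc (2 * t′) * ℓ + 4 + ℓ ≡ 2 * (suc t′ * ℓ) + 2 + 2
  regroup = solve-∀

no-long-branch-arith : ∀ n D → 2 * D + 2 ≤ n → suc (suc n) ≤ D → ⊥
no-long-branch-arith n D short long = <-irrefl refl (begin-strict
  D              ≤⟨ m≤m+n D (D + 0) ⟩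
  2 * D          <⟨ m<m+n (2 * D) z<s ⟩
  2 * D + 2      ≤⟨ short ⟩
  n              <⟨ ≤-trans (n≤1+n (suc n)) long ⟩
  D              ∎)
  where open ≤-Reasoning

module PowersOfV {s} (x : Word s) (n : ℕ) (w U V : FWord s) (shape : InftyShape x n w U V)
  (rs-w : RightSpecial x w) (complexity : ∀ m → n < m → ComplexityRatioAtMost x m 4 3) (ess : EssRightSpecial x U) where

  open import Algebra.Solver.Monoid (++-monoid (Fin s)) using (solve; _⊕_; _⊜_)

  ∣w∣≡n : length w ≡ n
  ∣w∣≡n = proj₁ shape
  w-factor : Factor x w
  w-factor = proj₁ (proj₂ shape)
  special⇒w : ∀ (u : FWord s) → length u ≡ n → Factor x u → LeftSpecial x u ⊎ RightSpecial x u → u ≡ w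
  special⇒w = proj₁ (proj₂ (proj₂ shape))
  rU : ReturnPath x n w U
  rU = proj₁ (proj₂ (proj₂ (proj₂ shape)))
  rV : ReturnPath x n w V
  rV = proj₁ (proj₂ (proj₂ (proj₂ (proj₂ shape))))
  U≢V : U ≢ V
  U≢V = proj₁ (proj₂ (proj₂ (proj₂ (proj₂ (proj₂ shape)))))

  open ReturnPaths x n w ∣w∣≡n special⇒w
  open Loop (loop rU) renaming (out to hU; outRest to tU; front to fU; into to cU; after-w to U-after; before-w to U-before)
  open Loop (loop rV) renaming (out to hV; outRest to tV; front to fV; into to cV; after-w to V-after; before-w to V-before)

  k ℓ : ℕ
  k = pathLen n U
  ℓ = pathLen n V
  -- U = w U′ = U″ w and V = w V′ = V″ w
  U′ V′ U″ V″ : FWord s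
  U′ = hU ∷ tU
  V′ = hV ∷ tV
  U″ = fU ++ [ cU ]
  V″ = fV ++ [ cV ]

  hU≢hV : hU ≢ hV
  hU≢hV hU≡hV = U≢V (determined-by-first-letter rU rV U-after (subst (λ c → V ≡ w ++ c ∷ tV) (sym hU≡hV) V-after))

  cV≢cU : cV ≢ cU
  cV≢cU cV≡cU = U≢V (determined-by-last-letter rU rV U-before (subst (λ c → V ≡ fV ++ c ∷ w) cV≡cU V-before))

  k+ℓ-long : suc (suc n) ≤ k + ℓ
  k+ℓ-long = returnPaths-long w-factor rU rV U≢V

  drop-w : ∀ X → drop n (w ++ X) ≡ X
  drop-w X = subst (λ m → drop m (w ++ X) ≡ X) ∣w∣≡n (drop-++-length w X)

  V-conjugate : w ++ V′ ≡ V″ ++ w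
  V-conjugate = trans (sym V-after) (trans V-before (sym (∷ʳ-++ fV cV w)))

  length-V′ : length V′ ≡ ℓ
  length-V′ = +-cancelʳ-≡ n _ _ (begin
    length V′ + n   ≡⟨ +-comm (length V′) n ⟩
    n + length V′   ≡⟨ cong (_+ length V′) ∣w∣≡n ⟨
    length w + length V′ ≡⟨ length-++ w ⟨
    length (w ++ V′) ≡⟨ cong length V-after ⟨
    length V        ≡⟨ Return.length≡ rV ⟩
    ℓ + n           ∎)
    where open ≡-Reasoning

  pathPow-V : ∀ b → pathPow n V b ≡ w ++ power b V′
  pathPow-V zero          = trans (Return.start rV) (sym (++-identityʳ w))
  pathPow-V (suc zero)    = trans V-after (cong (w ++_) (sym (++-identityʳ V′)))
  pathPow-V (suc (suc b)) = begin
    V ++ drop n (pathPow n V (suc b))  ≡⟨ cong (λ P → V ++ drop n P) (pathPow-V (suc b)) ⟩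
    V ++ drop n (w ++ power (suc b) V′) ≡⟨ cong (V ++_) (drop-w (power (suc b) V′)) ⟩
    V ++ power (suc b) V′              ≡⟨ cong (_++ power (suc b) V′) V-after ⟩
    (w ++ V′) ++ power (suc b) V′      ≡⟨ ++-assoc w V′ _ ⟩
    w ++ power (suc (suc b)) V′        ∎
    where open ≡-Reasoning

  UVᵇU : ∀ b → U ⋆⟨ n ⟩ (pathPow n V b ⋆⟨ n ⟩ U) ≡ U ++ power b V′ ++ U′
  UVᵇU b = begin
    U ++ drop n (pathPow n V b ++ drop n U)       ≡⟨ cong (λ P → U ++ drop n (P ++ drop n U)) (pathPow-V b) ⟩
    U ++ drop n ((w ++ power b V′) ++ drop n U)   ≡⟨ cong (λ P → U ++ drop n ((w ++ power b V′) ++ drop n P)) U-after ⟩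
    U ++ drop n ((w ++ power b V′) ++ drop n (w ++ U′)) ≡⟨ cong (λ X → U ++ drop n ((w ++ power b V′) ++ X)) (drop-w U′) ⟩
    U ++ drop n ((w ++ power b V′) ++ U′)         ≡⟨ cong (λ X → U ++ drop n X) (++-assoc w (power b V′) U′) ⟩
    U ++ drop n (w ++ power b V′ ++ U′)           ≡⟨ cong (U ++_) (drop-w (power b V′ ++ U′)) ⟩
    U ++ power b V′ ++ U′                         ∎
    where open ≡-Reasoning

  U-split : U ≡ U″ ++ w
  U-split = trans U-before (sym (∷ʳ-++ fU cU w))

  power-V-ends-in-cV : ∀ t → w ++ power (suc t) V′ ≡ (power t V″ ++ fV) ++ cV ∷ w
  power-V-ends-in-cV t = begin
    w ++ power (suc t) V′             ≡⟨ power-conjugate w V′ V″ V-conjugate (suc t) ⟩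
    power (suc t) V″ ++ w             ≡⟨ cong (_++ w) (power-suc t V″) ⟩
    (power t V″ ++ (fV ++ [ cV ])) ++ w ≡⟨ solve 4 (λ a b c d → (a ⊕ (b ⊕ c)) ⊕ d ⊜ (a ⊕ b) ⊕ (c ⊕ d)) refl (power t V″) fV [ cV ] w ⟩
    (power t V″ ++ fV) ++ cV ∷ w      ∎
    where open ≡-Reasoning

  length-power-V′ : ∀ b → length (power b V′) ≡ b * ℓ
  length-power-V′ b = trans (length-power b V′) (cong (b *_) length-V′)

  UVᵇU-length-bound : ∀ b → 2 ≤ b → Factor x (U ⋆⟨ n ⟩ (pathPow n V b ⋆⟨ n ⟩ U)) → (2 * b ∸ 3) * pathLen n V + 4 ≤ pathLen n U
  UVᵇU-length-bound (suc zero)     (s≤s ())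
  UVᵇU-length-bound (suc (suc t′)) _ fac = length-bound-arith t′ ℓ n k
    (branch-bound x ∣w∣≡n rs-w complexity ess U-before (t * ℓ) (subst (RightSpecial x) (power-V-ends-in-cV t′) rs-A) cV≢cU
      (trans (cong length (sym (power-V-ends-in-cV t′))) ∣A∣))
    k+ℓ-long
    where
    t = suc t′
    P = power t V′
    A = w ++ P
    F : Factor x (U ++ power (suc t) V′ ++ U′)
    F = subst (Factor x) (UVᵇU (suc t)) fac
    A-hU : Factor x (A ++ [ hU ])
    A-hU = factor-infix x (U″ ++ V″) (A ++ [ hU ]) tU (subst (Factor x) (begin
      U ++ (V′ ++ P) ++ U′                     ≡⟨ cong (λ X → X ++ (V′ ++ P) ++ U′) U-split ⟩
      (U″ ++ w) ++ (V′ ++ P) ++ [ hU ] ++ tU   ≡⟨ solve 6 (λ a b c d e f → (a ⊕ b) ⊕ ((c ⊕ d) ⊕ (e ⊕ f)) ⊜ a ⊕ ((b ⊕ c) ⊕ (d ⊕ (e ⊕ f)))) refl U″ w V′ P [ hU ] tU ⟩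
      U″ ++ (w ++ V′) ++ P ++ [ hU ] ++ tU     ≡⟨ cong (λ X → U″ ++ X ++ P ++ [ hU ] ++ tU) V-conjugate ⟩
      U″ ++ (V″ ++ w) ++ P ++ [ hU ] ++ tU     ≡⟨ solve 6 (λ a b c d e f → a ⊕ ((b ⊕ c) ⊕ (d ⊕ (e ⊕ f))) ⊜ (a ⊕ b) ⊕ (((c ⊕ d) ⊕ e) ⊕ f)) refl U″ V″ w P [ hU ] tU ⟩
      (U″ ++ V″) ++ (A ++ [ hU ]) ++ tU        ∎) F)
      where open ≡-Reasoning
    A-hV : Factor x (A ++ [ hV ])
    A-hV = factor-infix x U″ (A ++ [ hV ]) (tV ++ U′) (subst (Factor x) (begin
      U ++ power (suc t) V′ ++ U′              ≡⟨ cong₂ (λ X Y → X ++ Y ++ U′) U-split (power-suc t V′) ⟩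
      (U″ ++ w) ++ (P ++ [ hV ] ++ tV) ++ U′   ≡⟨ solve 6 (λ a b c d e f → (a ⊕ b) ⊕ ((c ⊕ (d ⊕ e)) ⊕ f) ⊜ a ⊕ (((b ⊕ c) ⊕ d) ⊕ (e ⊕ f))) refl U″ w P [ hV ] tV U′ ⟩
      U″ ++ (A ++ [ hV ]) ++ tV ++ U′          ∎) F)
      where open ≡-Reasoning
    rs-A : RightSpecial x A
    rs-A = hU , hV , hU≢hV , A-hU , A-hV
    ∣A∣ : length A ≡ n + t * ℓ
    ∣A∣ = trans (length-++ w) (cong₂ _+_ ∣w∣≡n (length-power-V′ t))

  larger-power-impossible : ∀ b b′ → 1 ≤ b → b < b′ →
                            Factor x (U ⋆⟨ n ⟩ (pathPow n V b ⋆⟨ n ⟩ U)) → Factor x (U ⋆⟨ n ⟩ (pathPow n V b′ ⋆⟨ n ⟩ U)) → ⊥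
  larger-power-impossible (suc t) b′ _ b<b′ fac fac′ = no-long-branch-arith n (k + b * ℓ)
    (branch-bound x ∣w∣≡n rs-w complexity ess U-before (k + b * ℓ) (subst (RightSpecial x) A-form rs-A) cV≢cU
      (trans (cong length (sym A-form)) ∣A∣))
    (≤-trans k+ℓ-long (+-monoʳ-≤ k (m≤m+n ℓ (t * ℓ))))
    where
    b = suc t
    r = proj₁ (m≤n⇒∃[o]m+o≡n b<b′)
    P = power b V′
    A = U ++ P
    A-hU : Factor x (A ++ [ hU ])
    A-hU = factor-++ˡ x (A ++ [ hU ]) tU
      (subst (Factor x) (trans (UVᵇU b) (sym (solve 4 (λ a b c d → ((a ⊕ b) ⊕ c) ⊕ d ⊜ a ⊕ (b ⊕ (c ⊕ d))) refl U P [ hU ] tU))) fac)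
    A-hV : Factor x (A ++ [ hV ])
    A-hV = factor-++ˡ x (A ++ [ hV ]) (tV ++ power r V′ ++ U′) (subst (Factor x) (begin
      U ⋆⟨ n ⟩ (pathPow n V b′ ⋆⟨ n ⟩ U)       ≡⟨ UVᵇU b′ ⟩
      U ++ power b′ V′ ++ U′                   ≡⟨ cong (λ m → U ++ power m V′ ++ U′) (proj₂ (m≤n⇒∃[o]m+o≡n b<b′)) ⟨
      U ++ power (suc b + r) V′ ++ U′          ≡⟨ cong (λ X → U ++ X ++ U′) (trans (power-+ (suc b) r V′) (cong (_++ power r V′) (power-suc b V′))) ⟩
      U ++ ((P ++ [ hV ] ++ tV) ++ power r V′) ++ U′
                                               ≡⟨ solve 6 (λ a b c d e f → a ⊕ (((b ⊕ (c ⊕ d)) ⊕ e) ⊕ f) ⊜ ((a ⊕ b) ⊕ c) ⊕ (d ⊕ (e ⊕ f))) refl U P [ hV ] tV (power r V′) U′ ⟩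
      (A ++ [ hV ]) ++ tV ++ power r V′ ++ U′  ∎) fac′)
      where open ≡-Reasoning
    rs-A : RightSpecial x A
    rs-A = hU , hV , hU≢hV , A-hU , A-hV
    A-form : A ≡ (U″ ++ power t V″ ++ fV) ++ cV ∷ w
    A-form = begin
      U ++ P                                   ≡⟨ cong (_++ P) U-split ⟩
      (U″ ++ w) ++ P                           ≡⟨ ++-assoc U″ w P ⟩
      U″ ++ (w ++ P)                           ≡⟨ cong (U″ ++_) (power-V-ends-in-cV t) ⟩
      U″ ++ (power t V″ ++ fV) ++ cV ∷ w       ≡⟨ solve 4 (λ a b c d → a ⊕ ((b ⊕ c) ⊕ d) ⊜ (a ⊕ (b ⊕ c)) ⊕ d) refl U″ (power t V″) fV (cV ∷ w) ⟩
      (U″ ++ power t V″ ++ fV) ++ cV ∷ w       ∎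
      where open ≡-Reasoning
    ∣A∣ : length A ≡ n + (k + b * ℓ)
    ∣A∣ = begin
      length (U ++ P)          ≡⟨ length-++ U ⟩
      length U + length P      ≡⟨ cong₂ _+_ (Return.length≡ rU) (length-power-V′ b) ⟩
      k + n + b * ℓ            ≡⟨ cong (_+ b * ℓ) (+-comm k n) ⟩
      n + k + b * ℓ            ≡⟨ +-assoc n k (b * ℓ) ⟩
      n + (k + b * ℓ)          ∎
      where open ≡-Reasoning

  UVᵇU-exponent-unique : ∀ b b′ → 1 ≤ b → 1 ≤ b′ →
            Factor x (U ⋆⟨ n ⟩ (pathPow n V b ⋆⟨ n ⟩ U)) → Factor x (U ⋆⟨ n ⟩ (pathPow n V b′ ⋆⟨ n ⟩ U)) → b ≡ b′
  UVᵇU-exponent-unique b b′ 1≤b 1≤b′ fac fac′ with <-cmp b b′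
  ... | tri< b<b′ _ _ = ⊥-elim (larger-power-impossible b b′ 1≤b b<b′ fac fac′)
  ... | tri≈ _ b≡b′ _ = b≡b′
  ... | tri> _ _ b′<b = ⊥-elim (larger-power-impossible b′ b 1≤b′ b′<b fac′ fac)

lemma3p1 : ∀ {s} (x : Word s) → ¬ UltPeriodic x →
    ∀ (n : ℕ) → 1 ≤ n →
    ∀ (w U V : FWord s) → InftyShape x n w U V → Bispecial x w →
    (∀ m → n < m → ComplexityRatioAtMost x m 4 3) →
    EssRightSpecial x U →
    (∀ b → 2 ≤ b →
       Factor x (U ⋆⟨ n ⟩ (pathPow n V b ⋆⟨ n ⟩ U)) →
       (2 * b ∸ 3) * pathLen n V + 4 ≤ pathLen n U)
    × (∀ b b′ → 1 ≤ b → 1 ≤ b′ →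
       Factor x (U ⋆⟨ n ⟩ (pathPow n V b ⋆⟨ n ⟩ U)) →
       Factor x (U ⋆⟨ n ⟩ (pathPow n V b′ ⋆⟨ n ⟩ U)) →
       b ≡ b′)
lemma3p1 x _ n _ w U V shape (_ , rs-w) complexity ess = UVᵇU-length-bound , UVᵇU-exponent-unique
  where open PowersOfV x n w U V shape rs-w complexity ess
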